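{- For $n\ge 0$ let $I_n(x)=\prod_{i=1}^n\left(1+x^{F_{i+1}}\right)$ (so $I_0(x)=1$), where $F_j$ are the Fibonacci numbers with $F_1=F_2=1$, $F_{j+1}=F_j+F_{j-1}$. Write $I_n(x)=\sum_{k\ge 0}c_n(k)x^k$ and set $v_2(n)=\sum_{k\ge 0}c_n(k)^2$ (so $v_2(0)=1$, $v_2(1)=2$, $v_2(2)=4$, $v_2(3)=10$). Then $$\sum_{n\ge 0}v_2(n)x^n=\frac{1-2x^2}{1-2x-2x^2+2x^3}.$$ -}

module Defs where

open import Data.Nat using (ℕ; zero; suc; _+_; _*_; _∸_)
open import Data.Integer as ℤ using (ℤ; +_)
open import Data.List using (List; []; _∷_; map; upTo; replicate; _++_; foldr)
open import Data.Nat.ListAction using (sum)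

fib : ℕ → ℕ
fib zero = zero
fib (suc zero) = suc zero
fib (suc (suc j)) = fib (suc j) + fib j

-- Polynomials with natural coefficients, as coefficient lists (constant term first).
Poly : Set
Poly = List ℕ

_⊕_ : Poly → Poly → Poly
[] ⊕ q = q
(a ∷ p) ⊕ [] = a ∷ p
(a ∷ p) ⊕ (b ∷ q) = (a + b) ∷ (p ⊕ q)

scale : ℕ → Poly → Poly
scale a = map (a *_)

_⊗_ : Poly → Poly → Poly
p ⊗ q = foldr (λ a acc → scale a q ⊕ (0 ∷ acc)) [] p

onePoly : Poly
onePoly = 1 ∷ []

monomial : ℕ → Poly
monomial m = replicate m 0 ++ (1 ∷ [])

I : ℕ → Poly
I zero = onePoly
I (suc n) = I n ⊗ (onePoly ⊕ monomial (fib (suc (suc n))))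

v₂ : ℕ → ℕ
v₂ n = sum (map (λ c → c * c) (I n))

Series : Set
Series = ℕ → ℤ

_⋆_ : Series → Series → Series
(f ⋆ g) n = foldr ℤ._+_ (+ 0) (map (λ k → f k ℤ.* g (n ∸ k)) (upTo (suc n)))

V : Series
V n = + v₂ n

numer : Series
numer 0 = + 1
numer 2 = ℤ.- (+ 2)
numer _ = + 0

denom : Series
denom 0 = + 1
denom 1 = ℤ.- (+ 2)
denom 2 = ℤ.- (+ 2)
denom 3 = + 2
denom _ = + 0

-- Multiplying I_n by 1 + x^F, F = F_{n+2}, adds a copy of I_n shifted by F, and
-- deg I_n < F_{n+3} = F_{n+2} + F_{n+1}. So the autocorrelations c of I_n at the lags
-- 0, F_{n+2}, F_{n+1}, written v, a, b, evolve linearly (every other lag that appears exceeds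
-- the degree): v' = 2v + 2a, a' = b, b' = v + 2a. Eliminating a and b gives
-- v(n+4) = 2v(n+3) + 2v(n+2) − 2v(n+1), i.e. denom ⋆ V vanishes in degrees ≥ 4; degrees 0–3
-- are checked by computation.
module Submission where

open import Defs
open import Data.Nat using (ℕ)
open import Relation.Binary.PropositionalEquality using (_≡_)

open import Data.Nat using (zero; suc; _+_; _*_; _∸_; _≤_; _<_; _⊔_)
open import Data.Nat.Properties
open import Data.Nat.Tactic.RingSolver using (solve-∀)
open import Data.Integer as ℤ using (ℤ; +_)
import Data.Integer.Properties as ℤ
import Data.Integer.Tactic.RingSolver as ℤ-Solver
open import Data.List using (List; []; _∷_; map; replicate; _++_; foldr; drop; length; applyUpTo)
open import Data.List.Properties using (drop-drop; drop-all; length-++; length-replicate; map-++; map-replicate)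
open import Data.Nat.ListAction using (sum)
open import Data.Product using (∃; ∃₂; _,_)
open import Function using (_∘_)
open import Relation.Binary.PropositionalEquality using (refl; sym; trans; cong; cong₂; module ≡-Reasoning)

open ≡-Reasoning

shift : ℕ → Poly → Poly
shift m p = replicate m 0 ++ p

⊕-identityʳ : ∀ p → p ⊕ [] ≡ p
⊕-identityʳ []      = refl
⊕-identityʳ (a ∷ p) = refl

⊕-comm : ∀ p q → p ⊕ q ≡ q ⊕ p
⊕-comm []      q       = sym (⊕-identityʳ q)
⊕-comm (a ∷ p) []      = refl
⊕-comm (a ∷ p) (b ∷ q) = cong₂ _∷_ (+-comm a b) (⊕-comm p q)

⊕-assoc : ∀ p q r → (p ⊕ q) ⊕ r ≡ p ⊕ (q ⊕ r)
⊕-assoc []      q       r       = refl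
⊕-assoc (a ∷ p) []      r       = refl
⊕-assoc (a ∷ p) (b ∷ q) []      = refl
⊕-assoc (a ∷ p) (b ∷ q) (c ∷ r) = cong₂ _∷_ (+-assoc a b c) (⊕-assoc p q r)

⊕-swap : ∀ p q r → p ⊕ (q ⊕ r) ≡ q ⊕ (p ⊕ r)
⊕-swap p q r = begin
  p ⊕ (q ⊕ r)  ≡⟨ sym (⊕-assoc p q r) ⟩
  (p ⊕ q) ⊕ r  ≡⟨ cong (_⊕ r) (⊕-comm p q) ⟩
  (q ⊕ p) ⊕ r  ≡⟨ ⊕-assoc q p r ⟩
  q ⊕ (p ⊕ r)  ∎

scale-shift : ∀ a m p → scale a (shift m p) ≡ shift m (scale a p)
scale-shift a m p = begin
  map (a *_) (replicate m 0 ++ p)           ≡⟨ map-++ (a *_) (replicate m 0) p ⟩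
  map (a *_) (replicate m 0) ++ scale a p   ≡⟨ cong (_++ scale a p) (map-replicate (a *_) m 0) ⟩
  replicate m (a * 0) ++ scale a p          ≡⟨ cong (λ z → replicate m z ++ scale a p) (*-zeroʳ a) ⟩
  shift m (scale a p)                       ∎

shift-[-]-⊕-shift-suc : ∀ m a p → shift m (a ∷ []) ⊕ shift (suc m) p ≡ shift m (a ∷ p)
shift-[-]-⊕-shift-suc zero    a p = cong (_∷ p) (+-identityʳ a)
shift-[-]-⊕-shift-suc (suc m) a p = cong (0 ∷_) (shift-[-]-⊕-shift-suc m a p)

⊗-one+monomial : ∀ m a p →
  (a ∷ p) ⊗ (onePoly ⊕ monomial (suc m)) ≡ (a ∷ p) ⊕ shift (suc m) (a ∷ p)
⊗-one+monomial m a [] =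
  cong₂ _∷_ (cong (_+ 0) (*-identityʳ a))
            (trans (⊕-identityʳ _) (trans (scale-shift a m (1 ∷ [])) (cong (λ z → shift m (z ∷ [])) (*-identityʳ a))))
⊗-one+monomial m a (b ∷ p) rewrite ⊗-one+monomial m b p =
  cong₂ _∷_ (cong (_+ 0) (*-identityʳ a)) (begin
    scale a (shift m (1 ∷ [])) ⊕ ((b ∷ p) ⊕ shift (suc m) (b ∷ p))
      ≡⟨ cong (_⊕ ((b ∷ p) ⊕ shift (suc m) (b ∷ p))) (scale-shift a m (1 ∷ [])) ⟩
    shift m (a * 1 ∷ []) ⊕ ((b ∷ p) ⊕ shift (suc m) (b ∷ p))
      ≡⟨ ⊕-swap (shift m (a * 1 ∷ [])) (b ∷ p) (shift (suc m) (b ∷ p)) ⟩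
    (b ∷ p) ⊕ (shift m (a * 1 ∷ []) ⊕ shift (suc m) (b ∷ p))
      ≡⟨ cong ((b ∷ p) ⊕_) (shift-[-]-⊕-shift-suc m (a * 1) (b ∷ p)) ⟩
    (b ∷ p) ⊕ shift m (a * 1 ∷ b ∷ p)
      ≡⟨ cong (λ z → (b ∷ p) ⊕ shift m (z ∷ b ∷ p)) (*-identityʳ a) ⟩
    (b ∷ p) ⊕ shift m (a ∷ b ∷ p)
      ∎)

length-⊕ : ∀ p q → length (p ⊕ q) ≡ length p ⊔ length q
length-⊕ []      q       = refl
length-⊕ (a ∷ p) []      = refl
length-⊕ (a ∷ p) (b ∷ q) = cong suc (length-⊕ p q)

length-shift : ∀ m p → length (shift m p) ≡ m + length p
length-shift m p = trans (length-++ (replicate m 0)) (cong (_+ length p) (length-replicate m))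

length-⊕-shift : ∀ m p → length (p ⊕ shift m p) ≡ m + length p
length-⊕-shift m p = begin
  length (p ⊕ shift m p)              ≡⟨ length-⊕ p (shift m p) ⟩
  length p ⊔ length (shift m p)       ≡⟨ cong (length p ⊔_) (length-shift m p) ⟩
  length p ⊔ (m + length p)           ≡⟨ m≤n⇒m⊔n≡n (m≤n+m (length p) m) ⟩
  m + length p                        ∎

dot : Poly → Poly → ℕ
dot []      q       = 0
dot (a ∷ p) []      = 0
dot (a ∷ p) (b ∷ q) = a * b + dot p q

autocorr : Poly → ℕ → ℕ
autocorr p s = dot (drop s p) p

dot-self : ∀ p → dot p p ≡ sum (map (λ c → c * c) p)
dot-self []      = refl
dot-self (a ∷ p) = cong (_+_ (a * a)) (dot-self p)

dot-comm : ∀ p q → dot p q ≡ dot q p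
dot-comm []      []      = refl
dot-comm []      (b ∷ q) = refl
dot-comm (a ∷ p) []      = refl
dot-comm (a ∷ p) (b ∷ q) = cong₂ _+_ (*-comm a b) (dot-comm p q)

dot-⊕ˡ : ∀ p q r → dot (p ⊕ q) r ≡ dot p r + dot q r
dot-⊕ˡ []      q       r       = refl
dot-⊕ˡ (a ∷ p) []      r       = sym (+-identityʳ _)
dot-⊕ˡ (a ∷ p) (b ∷ q) []      = refl
dot-⊕ˡ (a ∷ p) (b ∷ q) (c ∷ r) rewrite dot-⊕ˡ p q r =
  interchange a b c (dot p r) (dot q r)
  where
  interchange : ∀ a b c x y → (a + b) * c + (x + y) ≡ a * c + x + (b * c + y)
  interchange = solve-∀

dot-⊕ʳ : ∀ r p q → dot r (p ⊕ q) ≡ dot r p + dot r q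
dot-⊕ʳ r p q = begin
  dot r (p ⊕ q)          ≡⟨ dot-comm r (p ⊕ q) ⟩
  dot (p ⊕ q) r          ≡⟨ dot-⊕ˡ p q r ⟩
  dot p r + dot q r      ≡⟨ cong₂ _+_ (dot-comm p r) (dot-comm q r) ⟩
  dot r p + dot r q      ∎

dot-shiftʳ : ∀ m p q → dot p (shift m q) ≡ dot (drop m p) q
dot-shiftʳ zero    p       q = refl
dot-shiftʳ (suc m) []      q = refl
dot-shiftʳ (suc m) (a ∷ p) q = trans (cong (_+ dot p (shift m q)) (*-zeroʳ a)) (dot-shiftʳ m p q)

drop-⊕ : ∀ s p q → drop s (p ⊕ q) ≡ drop s p ⊕ drop s q
drop-⊕ zero    p       q       = refl
drop-⊕ (suc s) []      q       = refl
drop-⊕ (suc s) (a ∷ p) []      = sym (⊕-identityʳ _)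
drop-⊕ (suc s) (a ∷ p) (b ∷ q) = drop-⊕ s p q

drop-+-shift : ∀ m t p → drop (m + t) (shift m p) ≡ drop t p
drop-+-shift zero    t p = refl
drop-+-shift (suc m) t p = drop-+-shift m t p

drop-shift : ∀ m p → drop m (shift m p) ≡ p
drop-shift zero    p = refl
drop-shift (suc m) p = drop-shift m p

autocorr-beyond-length : ∀ p s → length p ≤ s → autocorr p s ≡ 0
autocorr-beyond-length p s h = cong (λ q → dot q p) (drop-all s p h)

autocorr-⊕-shift-0 : ∀ m p →
  autocorr (p ⊕ shift m p) 0 ≡ 2 * (autocorr p 0 + autocorr p m)
autocorr-⊕-shift-0 m p
  rewrite dot-⊕ˡ p (shift m p) (p ⊕ shift m p)
        | dot-⊕ʳ p p (shift m p)
        | dot-⊕ʳ (shift m p) p (shift m p)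
        | dot-comm (shift m p) p
        | dot-shiftʳ m p p
        | dot-shiftʳ m (shift m p) p
        | drop-shift m p
  = double (dot p p) (dot (drop m p) p)
  where
  double : ∀ x y → x + y + (y + x) ≡ 2 * (x + y)
  double = solve-∀

autocorr-⊕-shift-+ : ∀ m t p →
  autocorr (p ⊕ shift m p) (m + t)
    ≡ autocorr p (m + t) + autocorr p (m + t + m) + (autocorr p t + autocorr p (t + m))
autocorr-⊕-shift-+ m t p
  rewrite drop-⊕ (m + t) p (shift m p)
        | drop-+-shift m t p
        | dot-⊕ˡ (drop (m + t) p) (drop t p) (p ⊕ shift m p)
        | dot-⊕ʳ (drop (m + t) p) p (shift m p)
        | dot-⊕ʳ (drop t p) p (shift m p)
        | dot-shiftʳ m (drop (m + t) p) p
        | dot-shiftʳ m (drop t p) p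
        | drop-drop (m + t) m p
        | drop-drop t m p
  = refl

fib-suc-positive : ∀ n → ∃ λ m → fib (suc n) ≡ suc m
fib-suc-positive zero = 0 , refl
fib-suc-positive (suc n) with fib-suc-positive n
... | m , eq = m + fib n , cong (_+ fib n) eq

I-nonempty : ∀ n → ∃₂ λ a p → I n ≡ a ∷ p
I-nonempty zero = 1 , [] , refl
I-nonempty (suc n) with I-nonempty n | fib-suc-positive (suc n)
... | a , p , eq | m , F≡1+m rewrite eq | F≡1+m = _ , _ , ⊗-one+monomial m a p

I-suc : ∀ n → I (suc n) ≡ I n ⊕ shift (fib (2 + n)) (I n)
I-suc n with I-nonempty n | fib-suc-positive (suc n)
... | a , p , eq | m , F≡1+m rewrite eq | F≡1+m = ⊗-one+monomial m a p

length-I : ∀ n → suc (length (I n)) ≡ fib (3 + n)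
length-I zero = refl
length-I (suc n) = begin
  suc (length (I (suc n)))              ≡⟨ cong (suc ∘ length) (I-suc n) ⟩
  suc (length (I n ⊕ shift F (I n)))    ≡⟨ cong suc (length-⊕-shift F (I n)) ⟩
  suc (F + length (I n))                ≡⟨ sym (+-suc F (length (I n))) ⟩
  F + suc (length (I n))                ≡⟨ cong (_+_ F) (length-I n) ⟩
  F + fib (3 + n)                       ≡⟨ +-comm F (fib (3 + n)) ⟩
  fib (4 + n)                           ∎
  where F = fib (2 + n)

length-I-< : ∀ n → length (I n) < fib (2 + n) + fib (1 + n)
length-I-< n = ≤-reflexive (length-I n)

v a b : ℕ → ℕ
v n = autocorr (I n) 0
a n = autocorr (I n) (fib (2 + n))
b n = autocorr (I n) (fib (1 + n))

v₂≡v : ∀ n → v₂ n ≡ v n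
v₂≡v n = sym (dot-self (I n))

v-suc : ∀ n → v (suc n) ≡ 2 * (v n + a n)
v-suc n rewrite I-suc n = autocorr-⊕-shift-0 (fib (2 + n)) (I n)

a-suc : ∀ n → a (suc n) ≡ b n
a-suc n = begin
  autocorr (I (suc n)) (F + t)                   ≡⟨ cong (λ q → autocorr q (F + t)) (I-suc n) ⟩
  autocorr (I n ⊕ shift F (I n)) (F + t)         ≡⟨ autocorr-⊕-shift-+ F t (I n) ⟩
  c (F + t) + c (F + t + F) + (c t + c (t + F))
    ≡⟨ cong₂ (λ x y → x + y + (c t + c (t + F))) (vanishes (F + t) ≤-refl) (vanishes (F + t + F) (m≤m+n (F + t) F)) ⟩
  0 + 0 + (c t + c (t + F))                      ≡⟨ cong (_+_ (c t)) (vanishes (t + F) (≤-reflexive (+-comm F t))) ⟩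
  c t + 0                                        ≡⟨ +-identityʳ (c t) ⟩
  c t                                            ∎
  where
  F = fib (2 + n)
  t = fib (1 + n)
  c = autocorr (I n)
  vanishes : ∀ s → F + t ≤ s → c s ≡ 0
  vanishes s F+t≤s = autocorr-beyond-length (I n) s (≤-trans (<⇒≤ (length-I-< n)) F+t≤s)

b-suc : ∀ n → b (suc n) ≡ v n + 2 * a n
b-suc n = begin
  autocorr (I (suc n)) F                   ≡⟨ cong₂ autocorr (I-suc n) (sym (+-identityʳ F)) ⟩
  autocorr (I n ⊕ shift F (I n)) (F + 0)   ≡⟨ autocorr-⊕-shift-+ F 0 (I n) ⟩
  c (F + 0) + c (F + 0 + F) + (c 0 + c F)  ≡⟨ cong (λ k → c k + c (k + F) + (c 0 + c F)) (+-identityʳ F) ⟩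
  c F + c (F + F) + (c 0 + c F)            ≡⟨ cong (λ z → c F + z + (c 0 + c F)) (autocorr-beyond-length (I n) (F + F) L≤F+F) ⟩
  c F + 0 + (c 0 + c F)                    ≡⟨ rearrange (c F) (c 0) ⟩
  c 0 + 2 * c F                            ∎
  where
  F = fib (2 + n)
  c = autocorr (I n)
  L≤F+F : length (I n) ≤ F + F
  L≤F+F = <⇒≤ (≤-trans (length-I-< n) (+-monoʳ-≤ F (m≤m+n (fib (1 + n)) (fib n))))
  rearrange : ∀ x y → x + 0 + (y + x) ≡ y + 2 * x
  rearrange = solve-∀

system⇒v-recurrence : ∀ (v a b : ℕ → ℕ) →
  (∀ n → v (suc n) ≡ 2 * (v n + a n)) → (∀ n → a (suc n) ≡ b n) → (∀ n → b (suc n) ≡ v n + 2 * a n) →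
  ∀ m → v (4 + m) + 2 * v (1 + m) ≡ 2 * v (3 + m) + 2 * v (2 + m)
system⇒v-recurrence v a b v-suc a-suc b-suc m
  rewrite v-suc (3 + m) | a-suc (2 + m) | b-suc (1 + m) | v-suc (1 + m) =
  eliminate (v (3 + m)) (v (1 + m)) (a (1 + m))
  where
  eliminate : ∀ x y z → 2 * (x + (y + 2 * z)) + 2 * y ≡ 2 * x + 2 * (2 * (y + z))
  eliminate = solve-∀

v₂-recurrence : ∀ m → v₂ (4 + m) + 2 * v₂ (1 + m) ≡ 2 * v₂ (3 + m) + 2 * v₂ (2 + m)
v₂-recurrence m rewrite v₂≡v (4 + m) | v₂≡v (1 + m) | v₂≡v (3 + m) | v₂≡v (2 + m) =
  system⇒v-recurrence v a b v-suc a-suc b-suc m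

foldr-+-zeros : ∀ (h : ℕ → ℤ) f m → (∀ k → h (f k) ≡ + 0) →
  foldr ℤ._+_ (+ 0) (map h (applyUpTo f m)) ≡ + 0
foldr-+-zeros h f zero    h∘f≡0 = refl
foldr-+-zeros h f (suc m) h∘f≡0
  rewrite h∘f≡0 0 | foldr-+-zeros h (f ∘ suc) m (h∘f≡0 ∘ suc) = refl

denom⋆-from-4 : ∀ (u : Series) m →
  (denom ⋆ u) (4 + m) ≡ (u (4 + m) ℤ.+ + 2 ℤ.* u (1 + m)) ℤ.- (+ 2 ℤ.* u (3 + m) ℤ.+ + 2 ℤ.* u (2 + m))
denom⋆-from-4 u m
  rewrite foldr-+-zeros (λ k → denom k ℤ.* u (4 + m ∸ k)) (_+_ 4) (suc m) (λ k → refl) =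
  collect (u (4 + m)) (u (3 + m)) (u (2 + m)) (u (1 + m))
  where
  collect : ∀ a b c d →
    + 1 ℤ.* a ℤ.+ (ℤ.- (+ 2) ℤ.* b ℤ.+ (ℤ.- (+ 2) ℤ.* c ℤ.+ (+ 2 ℤ.* d ℤ.+ + 0)))
      ≡ (a ℤ.+ + 2 ℤ.* d) ℤ.- (+ 2 ℤ.* b ℤ.+ + 2 ℤ.* c)
  collect = ℤ-Solver.solve-∀

denom⋆-vanishes : ∀ (u : ℕ → ℕ) m →
  u (4 + m) + 2 * u (1 + m) ≡ 2 * u (3 + m) + 2 * u (2 + m) → (denom ⋆ (+_ ∘ u)) (4 + m) ≡ + 0
denom⋆-vanishes u m recurrence = begin
  (denom ⋆ (+_ ∘ u)) (4 + m)                                  ≡⟨ denom⋆-from-4 (+_ ∘ u) m ⟩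
  (+ u (4 + m) ℤ.+ + 2 ℤ.* + u (1 + m)) ℤ.- (+ 2 ℤ.* + u (3 + m) ℤ.+ + 2 ℤ.* + u (2 + m))
    ≡⟨ cong₂ ℤ._-_ (sym (pos-+-2* (u (4 + m)) (u (1 + m)))) (sym (pos-2*-+-2* (u (3 + m)) (u (2 + m)))) ⟩
  + (u (4 + m) + 2 * u (1 + m)) ℤ.- + (2 * u (3 + m) + 2 * u (2 + m))
    ≡⟨ cong (λ z → + z ℤ.- + (2 * u (3 + m) + 2 * u (2 + m))) recurrence ⟩
  + (2 * u (3 + m) + 2 * u (2 + m)) ℤ.- + (2 * u (3 + m) + 2 * u (2 + m))
    ≡⟨ ℤ.+-inverseʳ (+ (2 * u (3 + m) + 2 * u (2 + m))) ⟩
  + 0                                                         ∎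
  where
  pos-+-2* : ∀ x y → + (x + 2 * y) ≡ + x ℤ.+ + 2 ℤ.* + y
  pos-+-2* x y = trans (ℤ.pos-+ x (2 * y)) (cong (ℤ._+_ (+ x)) (ℤ.pos-* 2 y))
  pos-2*-+-2* : ∀ x y → + (2 * x + 2 * y) ≡ + 2 ℤ.* + x ℤ.+ + 2 ℤ.* + y
  pos-2*-+-2* x y = trans (ℤ.pos-+ (2 * x) (2 * y)) (cong₂ ℤ._+_ (ℤ.pos-* 2 x) (ℤ.pos-* 2 y))

theorem1 : (n : ℕ) → (denom ⋆ V) n ≡ numer n
theorem1 0 = refl
theorem1 1 = refl
theorem1 2 = refl
theorem1 3 = refl
theorem1 (suc (suc (suc (suc m)))) = denom⋆-vanishes v₂ m (v₂-recurrence m)
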